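{- Let $\rho^*:C^{\circledast}\otimes H^{\circledast}\to C^{\circledast}$ be the transpose of the coaction $\rho$, i.e. $\rho^*(f\otimes g)=(f\otimes g)\circ\rho$. Then for all $s\ge1$, $n_1,\dots,n_s\ge1$ and $k\ge1$, $$\rho^*(Z_{(0,n_1,\dots,n_s)}\otimes Z_{(k)})=\sum_{\substack{\delta_1+\dots+\delta_s=k\\\delta_i\in\mathbb{N}}}\binom{n_1+\delta_1}{n_1}\cdots\binom{n_s+\delta_s}{n_s}Z_{(0,n_1+\delta_1,\dots,n_s+\delta_s)},$$ and $\rho^*(1_{C^{\circledast}}\otimes Z_{(k)})=0$.
   Context: $\mathbb{K}$ is a field of characteristic $0$. $H=\mathbb{K}[(1)]$ is the polynomial Hopf algebra with $(1)$ primitive and basis $(m):=(1)^m$, $m\ge0$. $C=T\langle(0,n),n\ge1\rangle$ is the tensor algebra with basis $(0,n_1,\dots,n_q)=(0,n_1)\cdots(0,n_q)$ ($q\ge0$), concatenation product and each $(0,n)$ primitive. $\rho:C\to C\otimes H$ is defined by $\rho(1_C)=1_C\otimes1_H$ and, for $q\ge1$, $\rho((0,n_1,\dots,n_q))=\sum_{s=q}^{n_1+\dots+n_q-1}\sum_{k_1+\dots+k_q=s,\ 1\le k_j\le n_j}\binom{n_1}{k_1}\cdots\binom{n_q}{k_q}(0,k_1,\dots,k_q)\otimes(\sum_j(n_j-k_j))+(0,n_1,\dots,n_q)\otimes1_H$. $C^{\circledast}$, $H^{\circledast}$ are the graded duals with dual bases $(Z_{(0,n_1,\dots,n_s)})$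 and $(Z_{(k)})$; $1_{C^{\circledast}}$ is the dual of $1_C$. -}

module Defs where

open import Level using (Level; _⊔_; suc)
open import Algebra.Bundles using (CommutativeRing)
open import Data.Nat as ℕ using (ℕ; zero; _∸_; _≤_)
import Data.Nat.Properties as ℕP
open import Data.Nat.Combinatorics using (_C_)
open import Data.List using (List; []; _∷_; _++_; map; concatMap; filter; foldr; upTo; length; zipWith)
open import Data.Nat.ListAction using (sum)
import Data.List.Properties as LP
open import Data.Product using (_×_; _,_; Σ)
open import Relation.Nullary using (¬_; yes; no)
open import Relation.Binary.PropositionalEquality using (_≡_)

ringFromℕ : ∀ {c ℓ} (R : CommutativeRing c ℓ) → ℕ → CommutativeRing.Carrier R
ringFromℕ R zero      = CommutativeRing.0# R
ringFromℕ R (ℕ.suc n) = CommutativeRing._+_ R (CommutativeRing.1# R) (ringFromℕ R n)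

record Field (c ℓ : Level) : Set (Level.suc (c ⊔ ℓ)) where
  field
    commRing : CommutativeRing c ℓ
  open CommutativeRing commRing public
  field
    1≉0        : ¬ (1# ≈ 0#)
    inverse    : ∀ x → ¬ (x ≈ 0#) → Σ Carrier (λ y → (x * y) ≈ 1#)
    char-zero  : ∀ n → ¬ (ringFromℕ commRing (ℕ.suc n) ≈ 0#)

  fromℕ : ℕ → Carrier
  fromℕ = ringFromℕ commRing

-- Basis words of C:  (0,n₁,…,n_q)  is represented by the list n₁ ∷ … ∷ n_q
-- (q = 0, the empty list, is 1_C).  Basis of H: (m) represented by m : ℕ.

Word : Set
Word = List ℕ

boxes : List ℕ → List (List ℕ)
boxes []       = [] ∷ []
boxes (n ∷ ns) = concatMap (λ k → map (k ∷_) (boxes ns)) (map ℕ.suc (upTo n))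

compositions : ℕ → ℕ → List (List ℕ)
compositions zero      zero      = [] ∷ []
compositions zero      (ℕ.suc k) = []
compositions (ℕ.suc s) k         =
  concatMap (λ d → map (d ∷_) (compositions s (k ∸ d))) (upTo (ℕ.suc k))

range : ℕ → ℕ → List ℕ
range a b = map (a ℕ.+_) (upTo (ℕ.suc b ∸ a))

prodℕ : List ℕ → ℕ
prodℕ = foldr ℕ._*_ 1

module WithField {c ℓ} (𝕂 : Field c ℓ) where
  open Field 𝕂

  -- formal K-linear combinations of basis elements of C ⊗ H
  CH-Sum : Set c
  CH-Sum = List (Carrier × Word × ℕ)

  -- formal K-linear combinations of dual basis elements Z_w of C^⊛
  C*-Sum : Set c
  C*-Sum = List (Carrier × Word)

  ρ : Word → CH-Sum
  ρ []       = (1# , [] , 0) ∷ []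
  ρ ns@(_ ∷ _) =
    concatMap
      (λ s → map (λ ks → ( fromℕ (prodℕ (zipWith _C_ ns ks))
                         , ks
                         , sum (zipWith _∸_ ns ks)))
                 (filter (λ ks → sum ks ℕP.≟ s) (boxes ns)))
      (range (length ns) (sum ns ∸ 1))
    ++ ((1# , ns , 0) ∷ [])

  -- dual pairing ⟨Z_w ⊗ Z_(m), t⟩ : coefficient of w ⊗ (m) in t
  pairCH : Word → ℕ → CH-Sum → Carrier
  pairCH w m []                  = 0#
  pairCH w m ((a , v , j) ∷ t) with LP.≡-dec ℕP._≟_ v w | j ℕP.≟ m
  ... | yes _ | yes _ = a + pairCH w m t
  ... | _     | _     = pairCH w m t

  -- evaluation of a formal combination of Z's at a basis element v of C
  evalC* : C*-Sum → Word → Carrier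
  evalC* []            v = 0#
  evalC* ((a , w) ∷ f) v with LP.≡-dec ℕP._≟_ w v
  ... | yes _ = a + evalC* f v
  ... | no  _ = evalC* f v

  -- ρ*(Z_w ⊗ Z_(k)) = (Z_w ⊗ Z_(k)) ∘ ρ, as a functional on C (given on basis)
  ρ* : Word → ℕ → Word → Carrier
  ρ* w k v = pairCH w k (ρ v)

  rhs : Word → ℕ → C*-Sum
  rhs ns k = map (λ δs → ( fromℕ (prodℕ (zipWith (λ n d → (n ℕ.+ d) C n) ns δs))
                         , zipWith ℕ._+_ ns δs))
                 (compositions (length ns) k)

-- Both sides have coefficients of the form n · 1 with n natural, and at every basis word v
-- both coefficients are the same natural number: ∏ᵢ C(vᵢ, nᵢ) if length v = length ns,
-- nᵢ ≤ vᵢ and Σᵢ (vᵢ − nᵢ) = k, and 0 otherwise.  On the right only the composition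
-- δᵢ = vᵢ − nᵢ contributes.  On the left only the box kᵢ = nᵢ of ρ v contributes, and it
-- does so in exactly one degree slice s = Σ nᵢ, because Σ nᵢ = Σ vᵢ − k lies in the window
-- [length v, Σ vᵢ − 1] of degrees summed over in ρ.
module Submission where

open import Defs
open import Data.Nat using (ℕ; zero; suc; _+_; _*_; _∸_; _≤_; _<_; z≤n; s≤s; _≟_; _≤?_)
open import Data.Nat.Properties
open import Data.Nat.Combinatorics using (_C_)
open import Data.Nat.ListAction using (sum)
open import Data.Nat.ListAction.Properties using (sum-++)
open import Data.Nat.Tactic.RingSolver using (solve-∀)
open import Algebra.Properties.CommutativeSemigroup +-commutativeSemigroup
  using () renaming (interchange to +-interchange)
open import Data.List using (List; []; _∷_; _++_; map; concatMap; filter; upTo; length; zipWith)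
import Data.List.Properties as List
open import Data.List.Relation.Unary.All using (All; []; _∷_)
open import Data.Product using (_×_; _,_; proj₁; proj₂)
open import Data.Empty using (⊥-elim)
open import Function using (_∘_)
open import Relation.Nullary using (¬_; yes; no)
open import Relation.Binary.PropositionalEquality

δ : ℕ → ℕ → ℕ
δ zero    zero    = 1
δ zero    (suc n) = 0
δ (suc m) zero    = 0
δ (suc m) (suc n) = δ m n

δ-refl : ∀ n → δ n n ≡ 1
δ-refl zero    = refl
δ-refl (suc n) = δ-refl n

δ-≢ : ∀ {m n} → m ≢ n → δ m n ≡ 0
δ-≢ {zero}  {zero}  m≢n = ⊥-elim (m≢n refl)
δ-≢ {zero}  {suc n} m≢n = refl
δ-≢ {suc m} {zero}  m≢n = refl
δ-≢ {suc m} {suc n} m≢n = δ-≢ (m≢n ∘ cong suc)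

δ≢0⇒≡ : ∀ m n → δ m n ≢ 0 → m ≡ n
δ≢0⇒≡ zero    zero    _   = refl
δ≢0⇒≡ zero    (suc n) δ≢0 = ⊥-elim (δ≢0 refl)
δ≢0⇒≡ (suc m) zero    δ≢0 = ⊥-elim (δ≢0 refl)
δ≢0⇒≡ (suc m) (suc n) δ≢0 = cong suc (δ≢0⇒≡ m n δ≢0)

δ-sym : ∀ m n → δ m n ≡ δ n m
δ-sym zero    zero    = refl
δ-sym zero    (suc n) = refl
δ-sym (suc m) zero    = refl
δ-sym (suc m) (suc n) = δ-sym m n

δ-cancelˡ-+ : ∀ a m n → δ (a + m) (a + n) ≡ δ m n
δ-cancelˡ-+ zero    m n = refl
δ-cancelˡ-+ (suc a) m n = δ-cancelˡ-+ a m n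

θ : ℕ → ℕ → ℕ
θ zero    n       = 1
θ (suc m) zero    = 0
θ (suc m) (suc n) = θ m n

θ-≤ : ∀ {m n} → m ≤ n → θ m n ≡ 1
θ-≤ z≤n       = refl
θ-≤ (s≤s m≤n) = θ-≤ m≤n

θ-≰ : ∀ {m n} → ¬ m ≤ n → θ m n ≡ 0
θ-≰ {zero}  {n}     m≰n = ⊥-elim (m≰n z≤n)
θ-≰ {suc m} {zero}  m≰n = refl
θ-≰ {suc m} {suc n} m≰n = θ-≰ (m≰n ∘ s≤s)

θ≢0⇒≤ : ∀ m n → θ m n ≢ 0 → m ≤ n
θ≢0⇒≤ zero    n       _   = z≤n
θ≢0⇒≤ (suc m) zero    θ≢0 = ⊥-elim (θ≢0 refl)
θ≢0⇒≤ (suc m) (suc n) θ≢0 = s≤s (θ≢0⇒≤ m n θ≢0)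

δ-+ : ∀ a m n → δ (a + m) n ≡ θ a n * δ m (n ∸ a)
δ-+ zero    m n       = sym (+-identityʳ (δ m n))
δ-+ (suc a) m zero    = refl
δ-+ (suc a) m (suc n) = δ-+ a m n

δᴸ : Word → Word → ℕ
δᴸ []       []       = 1
δᴸ []       (_ ∷ _)  = 0
δᴸ (_ ∷ _)  []       = 0
δᴸ (m ∷ ms) (n ∷ ns) = δ m n * δᴸ ms ns

δᴸ-refl : ∀ ns → δᴸ ns ns ≡ 1
δᴸ-refl []       = refl
δᴸ-refl (n ∷ ns) rewrite δ-refl n | δᴸ-refl ns = refl

δᴸ-≢ : ∀ {ms ns} → ms ≢ ns → δᴸ ms ns ≡ 0
δᴸ-≢ {[]}     {[]}     ms≢ns = ⊥-elim (ms≢ns refl)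
δᴸ-≢ {[]}     {_ ∷ _}  ms≢ns = refl
δᴸ-≢ {_ ∷ _}  {[]}     ms≢ns = refl
δᴸ-≢ {m ∷ ms} {n ∷ ns} ms≢ns with m ≟ n
... | no m≢n    rewrite δ-≢ m≢n = refl
... | yes refl  rewrite δᴸ-≢ (ms≢ns ∘ cong (m ∷_)) = *-zeroʳ (δ m m)

*≢0⇒ˡ≢0 : ∀ m n → m * n ≢ 0 → m ≢ 0
*≢0⇒ˡ≢0 m n mn≢0 m≡0 = mn≢0 (cong (_* n) m≡0)

*≢0⇒ʳ≢0 : ∀ m n → m * n ≢ 0 → n ≢ 0
*≢0⇒ʳ≢0 m n mn≢0 n≡0 = mn≢0 (trans (cong (m *_) n≡0) (*-zeroʳ m))

∑ : {A : Set} → List A → (A → ℕ) → ℕ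
∑ xs f = sum (map f xs)

private variable A B : Set

∑-map : ∀ (g : A → B) (xs : List A) f → ∑ (map g xs) f ≡ ∑ xs (f ∘ g)
∑-map g xs f = cong sum (sym (List.map-∘ xs))

∑-cong : ∀ (xs : List A) {f g} → (∀ x → f x ≡ g x) → ∑ xs f ≡ ∑ xs g
∑-cong xs f≗g = cong sum (List.map-cong f≗g xs)

∑-++ : ∀ (xs ys : List A) f → ∑ (xs ++ ys) f ≡ ∑ xs f + ∑ ys f
∑-++ xs ys f = trans (cong sum (List.map-++ f xs ys)) (sum-++ (map f xs) (map f ys))

∑-zero : ∀ (xs : List A) → ∑ xs (λ _ → 0) ≡ 0
∑-zero []       = refl
∑-zero (x ∷ xs) = ∑-zero xs

∑-*ˡ : ∀ (xs : List A) c f → ∑ xs (λ x → c * f x) ≡ c * ∑ xs f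
∑-*ˡ []       c f = sym (*-zeroʳ c)
∑-*ˡ (x ∷ xs) c f = trans (cong (c * f x +_) (∑-*ˡ xs c f)) (sym (*-distribˡ-+ c (f x) _))

∑-*ʳ : ∀ (xs : List A) c f → ∑ xs (λ x → f x * c) ≡ ∑ xs f * c
∑-*ʳ []       c f = refl
∑-*ʳ (x ∷ xs) c f = trans (cong (f x * c +_) (∑-*ʳ xs c f)) (sym (*-distribʳ-+ c (f x) _))

∑-filter : ∀ (h : A → ℕ) s (xs : List A) f →
           ∑ (filter (λ x → h x ≟ s) xs) f ≡ ∑ xs (λ x → δ (h x) s * f x)
∑-filter h s []       f = refl
∑-filter h s (x ∷ xs) f with h x ≟ s
... | yes hx≡s rewrite List.filter-accept (λ y → h y ≟ s) {xs = xs} hx≡s | hx≡s | δ-refl s =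
  cong₂ _+_ (sym (+-identityʳ (f x))) (∑-filter h s xs f)
... | no hx≢s  rewrite List.filter-reject (λ y → h y ≟ s) {xs = xs} hx≢s | δ-≢ hx≢s =
  ∑-filter h s xs f

∑-concatMap-∷ : ∀ (F : A → List (List A)) (xs : List A) (f : List A → ℕ) →
                ∑ (concatMap (λ x → map (x ∷_) (F x)) xs) f ≡ ∑ xs (λ x → ∑ (F x) (λ ys → f (x ∷ ys)))
∑-concatMap-∷ F []       f = refl
∑-concatMap-∷ F (x ∷ xs) f =
  trans (∑-++ (map (x ∷_) (F x)) (concatMap (λ y → map (y ∷_) (F y)) xs) f)
        (cong₂ _+_ (∑-map (x ∷_) (F x) f) (∑-concatMap-∷ F xs f))

∑-upTo-δ : ∀ m n (f : ℕ → ℕ) → ∑ (upTo m) (λ j → δ j n * f j) ≡ θ (suc n) m * f n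
∑-upTo-δ zero    n       f = refl
∑-upTo-δ (suc m) zero    f rewrite sym (List.map-upTo suc m) | ∑-map suc (upTo m) (λ j → δ j 0 * f j)
  = trans (cong (f 0 + 0 +_) (∑-zero (upTo m))) (+-identityʳ _)
∑-upTo-δ (suc m) (suc n) f rewrite sym (List.map-upTo suc m) =
  trans (∑-map suc (upTo m) (λ j → δ j (suc n) * f j)) (∑-upTo-δ m n (f ∘ suc))

∑-range-δ : ∀ {a b t} → a ≤ t → t ≤ b → ∑ (range a b) (δ t) ≡ 1
∑-range-δ {a} {b} {t} a≤t t≤b = begin
  ∑ (map (a +_) (upTo (suc b ∸ a))) (δ t)         ≡⟨ ∑-map (a +_) (upTo (suc b ∸ a)) (δ t) ⟩
  ∑ (upTo (suc b ∸ a)) (λ s → δ t (a + s))        ≡⟨ ∑-cong (upTo (suc b ∸ a)) δ-shift ⟩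
  ∑ (upTo (suc b ∸ a)) (λ s → δ s (t ∸ a) * 1)    ≡⟨ ∑-upTo-δ (suc b ∸ a) (t ∸ a) (λ _ → 1) ⟩
  θ (suc (t ∸ a)) (suc b ∸ a) * 1                   ≡⟨ cong (_* 1) (θ-≤ t∸a<b+1∸a) ⟩
  1                                                 ∎
  where
  open ≡-Reasoning
  δ-shift : ∀ s → δ t (a + s) ≡ δ s (t ∸ a) * 1
  δ-shift s = begin
    δ t (a + s)             ≡⟨ cong (λ t′ → δ t′ (a + s)) (sym (m+[n∸m]≡n a≤t)) ⟩
    δ (a + (t ∸ a)) (a + s) ≡⟨ δ-cancelˡ-+ a (t ∸ a) s ⟩
    δ (t ∸ a) s             ≡⟨ δ-sym (t ∸ a) s ⟩
    δ s (t ∸ a)             ≡⟨ sym (*-identityʳ _) ⟩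
    δ s (t ∸ a) * 1         ∎
  t∸a<b+1∸a : suc (t ∸ a) ≤ suc b ∸ a
  t∸a<b+1∸a = subst (_≤ suc b ∸ a) (+-∸-assoc 1 a≤t) (∸-monoˡ-≤ a (s≤s t≤b))

length≤sum : ∀ ns → All (1 ≤_) ns → length ns ≤ sum ns
length≤sum []       []                   = z≤n
length≤sum (n ∷ ns) (s≤s {n = n′} _ ∷ ps) = s≤s (≤-trans (length≤sum ns ps) (m≤n+m (sum ns) n′))

coeff : Word → Word → ℕ → ℕ
coeff []       []      k = δ 0 k
coeff []       (_ ∷ _) k = 0
coeff (_ ∷ _)  []      k = 0
coeff (n ∷ ns) (x ∷ v) k = θ n x * (θ (x ∸ n) k * ((x C n) * coeff ns v (k ∸ (x ∸ n))))

coeff-support : ∀ ns v k → coeff ns v k ≢ 0 → sum ns + k ≡ sum v × length ns ≡ length v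
coeff-support []       []      k c≢0 = sym (δ≢0⇒≡ 0 k c≢0) , refl
coeff-support []       (_ ∷ _) k c≢0 = ⊥-elim (c≢0 refl)
coeff-support (_ ∷ _)  []      k c≢0 = ⊥-elim (c≢0 refl)
coeff-support (n ∷ ns) (x ∷ v) k c≢0 = sum-eq , cong suc length-eq
  where
  open ≡-Reasoning
  d  = x ∸ n
  k′ = k ∸ d
  c₁ = *≢0⇒ʳ≢0 (θ n x) _ c≢0
  c₂ = *≢0⇒ʳ≢0 (θ d k) _ c₁
  IH = coeff-support ns v k′ (*≢0⇒ʳ≢0 (x C n) _ c₂)
  sum-eq-tail = proj₁ IH
  length-eq   = proj₂ IH
  sum-eq : n + sum ns + k ≡ x + sum v
  sum-eq = begin
    n + sum ns + k          ≡⟨ cong (n + sum ns +_) (sym (m+[n∸m]≡n (θ≢0⇒≤ d k (*≢0⇒ˡ≢0 _ _ c₁)))) ⟩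
    n + sum ns + (d + k′)   ≡⟨ +-interchange n (sum ns) d k′ ⟩
    (n + d) + (sum ns + k′) ≡⟨ cong₂ _+_ (m+[n∸m]≡n (θ≢0⇒≤ n x (*≢0⇒ˡ≢0 _ _ c≢0))) sum-eq-tail ⟩
    x + sum v               ∎

boxWeight : Word → Word → ℕ → Word → ℕ
boxWeight v ns k ks = δᴸ ks ns * δ (sum (zipWith _∸_ v ks)) k * prodℕ (zipWith _C_ v ks)

∑-boxes : ∀ v ns k → All (1 ≤_) ns → ∑ (boxes v) (boxWeight v ns k) ≡ coeff ns v k
∑-boxes []      []       k _  = trans (+-identityʳ _) (trans (*-identityʳ _) (+-identityʳ _))
∑-boxes []      (_ ∷ _)  k _  = refl
∑-boxes (x ∷ v) []       k _  = begin
  ∑ (boxes (x ∷ v)) (boxWeight (x ∷ v) [] k)          ≡⟨ ∑-concatMap-∷ (λ _ → boxes v) (map suc (upTo x)) _ ⟩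
  ∑ (map suc (upTo x)) (λ _ → ∑ (boxes v) (λ _ → 0))  ≡⟨ ∑-cong (map suc (upTo x)) (λ _ → ∑-zero (boxes v)) ⟩
  ∑ (map suc (upTo x)) (λ _ → 0)                      ≡⟨ ∑-zero (map suc (upTo x)) ⟩
  0                                                   ∎
  where open ≡-Reasoning
∑-boxes (x ∷ v) (suc n ∷ ns) k (s≤s z≤n ∷ ps) = begin
  ∑ (boxes (x ∷ v)) W                                    ≡⟨ ∑-concatMap-∷ (λ _ → boxes v) (map suc (upTo x)) W ⟩
  ∑ (map suc (upTo x)) (λ j → ∑ (boxes v) (W ∘ (j ∷_)))  ≡⟨ ∑-map suc (upTo x) _ ⟩
  ∑ (upTo x) (λ j → ∑ (boxes v) (W ∘ (suc j ∷_)))        ≡⟨ ∑-cong (upTo x) first-box-entry ⟩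
  ∑ (upTo x) (λ j → δ j n * G j)                         ≡⟨ ∑-upTo-δ x n G ⟩
  θ (suc n) x * G n                                      ∎
  where
  open ≡-Reasoning
  W = boxWeight (x ∷ v) (suc n ∷ ns) k
  G : ℕ → ℕ
  G j = θ (x ∸ suc j) k * ((x C suc j) * coeff ns v (k ∸ (x ∸ suc j)))
  regroup : ∀ a b c e f h → a * b * (c * e) * (f * h) ≡ a * (c * f) * (b * e * h)
  regroup = solve-∀
  first-box-entry : ∀ j → ∑ (boxes v) (W ∘ (suc j ∷_)) ≡ δ j n * G j
  first-box-entry j = begin
    ∑ (boxes v) (W ∘ (suc j ∷_))                      ≡⟨ ∑-cong (boxes v) split ⟩
    ∑ (boxes v) (λ ks → c * boxWeight v ns (k ∸ d) ks) ≡⟨ ∑-*ˡ (boxes v) c _ ⟩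
    c * ∑ (boxes v) (boxWeight v ns (k ∸ d))           ≡⟨ cong (c *_) (∑-boxes v ns (k ∸ d) ps) ⟩
    c * coeff ns v (k ∸ d)                             ≡⟨ *-assoc (δ j n) _ _ ⟩
    δ j n * (θ d k * (x C suc j) * coeff ns v (k ∸ d)) ≡⟨ cong (δ j n *_) (*-assoc (θ d k) _ _) ⟩
    δ j n * G j                                        ∎
    where
    d = x ∸ suc j
    c = δ j n * (θ d k * (x C suc j))
    split : ∀ ks → W (suc j ∷ ks) ≡ c * boxWeight v ns (k ∸ d) ks
    split ks = trans (cong (λ e → δ j n * δᴸ ks ns * e * ((x C suc j) * prodℕ (zipWith _C_ v ks)))
                           (δ-+ d (sum (zipWith _∸_ v ks)) k))
                     (regroup (δ j n) (δᴸ ks ns) (θ d k) _ (x C suc j) _)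

compositionWeight : Word → Word → Word → ℕ
compositionWeight ns v δs = δᴸ (zipWith _+_ ns δs) v * prodℕ (zipWith (λ n d → (n + d) C n) ns δs)

∑-compositions : ∀ ns k v → ∑ (compositions (length ns) k) (compositionWeight ns v) ≡ coeff ns v k
∑-compositions []       zero    []      = refl
∑-compositions []       zero    (_ ∷ _) = refl
∑-compositions []       (suc k) []      = refl
∑-compositions []       (suc k) (_ ∷ _) = refl
∑-compositions (n ∷ ns) k       []      = begin
  ∑ (compositions (length (n ∷ ns)) k) (compositionWeight (n ∷ ns) [])
    ≡⟨ ∑-concatMap-∷ (λ d → compositions (length ns) (k ∸ d)) (upTo (suc k)) _ ⟩
  ∑ (upTo (suc k)) (λ d → ∑ (compositions (length ns) (k ∸ d)) (λ _ → 0))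
    ≡⟨ ∑-cong (upTo (suc k)) (λ d → ∑-zero (compositions (length ns) (k ∸ d))) ⟩
  ∑ (upTo (suc k)) (λ _ → 0)
    ≡⟨ ∑-zero (upTo (suc k)) ⟩
  0 ∎
  where open ≡-Reasoning
∑-compositions (n ∷ ns) k (x ∷ v) = begin
  ∑ (compositions (length (n ∷ ns)) k) W
    ≡⟨ ∑-concatMap-∷ (λ d → compositions (length ns) (k ∸ d)) (upTo (suc k)) W ⟩
  ∑ (upTo (suc k)) (λ d → ∑ (compositions (length ns) (k ∸ d)) (W ∘ (d ∷_)))
    ≡⟨ ∑-cong (upTo (suc k)) first-part ⟩
  ∑ (upTo (suc k)) (λ d → δ d (x ∸ n) * G d)
    ≡⟨ ∑-upTo-δ (suc k) (x ∸ n) G ⟩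
  θ (x ∸ n) k * G (x ∸ n)
    ≡⟨ close ⟩
  coeff (n ∷ ns) (x ∷ v) k ∎
  where
  open ≡-Reasoning
  W = compositionWeight (n ∷ ns) (x ∷ v)
  G : ℕ → ℕ
  G d = θ n x * ((n + d) C n) * coeff ns v (k ∸ d)
  regroup : ∀ a b c e f → a * b * c * (e * f) ≡ b * (a * e) * (c * f)
  regroup = solve-∀
  first-part : ∀ d → ∑ (compositions (length ns) (k ∸ d)) (W ∘ (d ∷_)) ≡ δ d (x ∸ n) * G d
  first-part d = begin
    ∑ cs (W ∘ (d ∷_))                          ≡⟨ ∑-cong cs split ⟩
    ∑ cs (λ δs → c * compositionWeight ns v δs) ≡⟨ ∑-*ˡ cs c _ ⟩
    c * ∑ cs (compositionWeight ns v)           ≡⟨ cong (c *_) (∑-compositions ns (k ∸ d) v) ⟩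
    c * coeff ns v (k ∸ d)                      ≡⟨ *-assoc (δ d (x ∸ n)) _ _ ⟩
    δ d (x ∸ n) * G d                           ∎
    where
    cs = compositions (length ns) (k ∸ d)
    c = δ d (x ∸ n) * (θ n x * ((n + d) C n))
    split : ∀ δs → W (d ∷ δs) ≡ c * compositionWeight ns v δs
    split δs = trans (cong (λ e → e * δᴸ (zipWith _+_ ns δs) v * (((n + d) C n) * prodℕ (zipWith (λ n d → (n + d) C n) ns δs)))
                           (δ-+ n d x))
                     (regroup (θ n x) (δ d (x ∸ n)) _ ((n + d) C n) _)
  close : θ (x ∸ n) k * G (x ∸ n) ≡ coeff (n ∷ ns) (x ∷ v) k
  close with n ≤? x
  ... | yes n≤x rewrite m+[n∸m]≡n n≤x = swap-θ (θ (x ∸ n) k) (θ n x) (x C n) _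
    where
    swap-θ : ∀ a b c e → a * (b * c * e) ≡ b * (a * (c * e))
    swap-θ = solve-∀
  ... | no n≰x  rewrite θ-≰ n≰x = *-zeroʳ (θ (x ∸ n) k)

∑-degree-window : ∀ ns v k → All (1 ≤_) ns → 1 ≤ k →
                  ∑ (range (length v) (sum v ∸ 1)) (δ (sum ns)) * coeff ns v k ≡ coeff ns v k
∑-degree-window ns v k ps k≥1 with coeff ns v k ≟ 0
... | yes c≡0 rewrite c≡0 = *-zeroʳ (∑ (range (length v) (sum v ∸ 1)) (δ (sum ns)))
... | no c≢0  = trans (cong (_* coeff ns v k) (∑-range-δ length≤ sum<)) (*-identityˡ _)
  where
  support = coeff-support ns v k c≢0
  length≤ : length v ≤ sum ns
  length≤ = subst (_≤ sum ns) (proj₂ support) (length≤sum ns ps)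
  sum< : sum ns ≤ sum v ∸ 1
  sum< = suc[m]≤n⇒m≤pred[n] (subst (sum ns <_) (proj₁ support) (m<m+n (sum ns) k≥1))

∑-degrees-boxes : ∀ v ns k → All (1 ≤_) ns → 1 ≤ k →
  ∑ (range (length v) (sum v ∸ 1)) (λ s → ∑ (filter (λ ks → sum ks ≟ s) (boxes v)) (boxWeight v ns k))
  ≡ coeff ns v k
∑-degrees-boxes v ns k ps k≥1 = begin
  ∑ R (λ s → ∑ (filter (λ ks → sum ks ≟ s) (boxes v)) W) ≡⟨ ∑-cong R (λ s → ∑-filter sum s (boxes v) W) ⟩
  ∑ R (λ s → ∑ (boxes v) (λ ks → δ (sum ks) s * W ks))    ≡⟨ ∑-cong R (λ s → ∑-cong (boxes v) (only-ns s)) ⟩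
  ∑ R (λ s → ∑ (boxes v) (λ ks → δ (sum ns) s * W ks))    ≡⟨ ∑-cong R (λ s → ∑-*ˡ (boxes v) (δ (sum ns) s) W) ⟩
  ∑ R (λ s → δ (sum ns) s * ∑ (boxes v) W)                ≡⟨ ∑-*ʳ R (∑ (boxes v) W) (δ (sum ns)) ⟩
  ∑ R (δ (sum ns)) * ∑ (boxes v) W                        ≡⟨ cong (∑ R (δ (sum ns)) *_) (∑-boxes v ns k ps) ⟩
  ∑ R (δ (sum ns)) * coeff ns v k                         ≡⟨ ∑-degree-window ns v k ps k≥1 ⟩
  coeff ns v k                                            ∎
  where
  open ≡-Reasoning
  R = range (length v) (sum v ∸ 1)
  W = boxWeight v ns k
  only-ns : ∀ s ks → δ (sum ks) s * W ks ≡ δ (sum ns) s * W ks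
  only-ns s ks with List.≡-dec _≟_ ks ns
  ... | yes refl = refl
  ... | no ks≢ns rewrite δᴸ-≢ ks≢ns = trans (*-zeroʳ (δ (sum ks) s)) (sym (*-zeroʳ (δ (sum ns) s)))

module _ {c ℓ} (𝕂 : Field c ℓ) where

  open Field 𝕂 using (_≈_; 0#; 1#; fromℕ; +-cong)
    renaming (_+_ to _+ᴷ_; +-assoc to +ᴷ-assoc; +-identityˡ to +ᴷ-identityˡ; +-identityʳ to +ᴷ-identityʳ;
              refl to ≈-refl; sym to ≈-sym; trans to ≈-trans; reflexive to ≈-reflexive)
  open WithField 𝕂

  fromℕ-+ : ∀ m n → fromℕ (m + n) ≈ fromℕ m +ᴷ fromℕ n
  fromℕ-+ zero    n = ≈-sym (+ᴷ-identityˡ _)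
  fromℕ-+ (suc m) n = ≈-trans (+-cong ≈-refl (fromℕ-+ m n)) (≈-sym (+ᴷ-assoc _ _ _))

  pairCH-++ : ∀ w m t u → pairCH w m (t ++ u) ≈ pairCH w m t +ᴷ pairCH w m u
  pairCH-++ w m []                u = ≈-sym (+ᴷ-identityˡ _)
  pairCH-++ w m ((a , v , j) ∷ t) u with List.≡-dec _≟_ v w | j ≟ m
  ... | yes _ | yes _ = ≈-trans (+-cong ≈-refl (pairCH-++ w m t u)) (≈-sym (+ᴷ-assoc _ _ _))
  ... | yes _ | no  _ = pairCH-++ w m t u
  ... | no  _ | _     = pairCH-++ w m t u

  pairCH-∷ : ∀ w m n v j t →
             pairCH w m ((fromℕ n , v , j) ∷ t) ≈ fromℕ (δᴸ v w * δ j m * n) +ᴷ pairCH w m t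
  pairCH-∷ w m n v j t with List.≡-dec _≟_ v w | j ≟ m
  ... | yes refl | yes refl rewrite δᴸ-refl v | δ-refl j = +-cong (≈-reflexive (cong fromℕ (sym (+-identityʳ n)))) ≈-refl
  ... | yes refl | no j≢m   rewrite δ-≢ j≢m | *-zeroʳ (δᴸ v v) = ≈-sym (+ᴷ-identityˡ _)
  ... | no v≢w   | _        rewrite δᴸ-≢ v≢w = ≈-sym (+ᴷ-identityˡ _)

  pairCH-degree-0 : ∀ w m a v → 1 ≤ m → pairCH w m ((a , v , 0) ∷ []) ≈ 0#
  pairCH-degree-0 w (suc m) a v _ with List.≡-dec _≟_ v w
  ... | yes _ = ≈-refl
  ... | no  _ = ≈-refl

  pairCH-map : ∀ w m (n : A → ℕ) (f : A → Word) (e : A → ℕ) xs →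
               pairCH w m (map (λ a → (fromℕ (n a) , f a , e a)) xs)
               ≈ fromℕ (∑ xs (λ a → δᴸ (f a) w * δ (e a) m * n a))
  pairCH-map w m n f e []       = ≈-refl
  pairCH-map w m n f e (a ∷ xs) =
    ≈-trans (pairCH-∷ w m (n a) (f a) (e a) _)
            (≈-trans (+-cong ≈-refl (pairCH-map w m n f e xs))
                     (≈-sym (fromℕ-+ (δᴸ (f a) w * δ (e a) m * n a) _)))

  pairCH-concatMap : ∀ w m (G : A → CH-Sum) (n : A → ℕ) xs →
                     (∀ a → pairCH w m (G a) ≈ fromℕ (n a)) →
                     pairCH w m (concatMap G xs) ≈ fromℕ (∑ xs n)
  pairCH-concatMap w m G n []       _ = ≈-refl
  pairCH-concatMap w m G n (a ∷ xs) G≈n =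
    ≈-trans (pairCH-++ w m (G a) (concatMap G xs))
            (≈-trans (+-cong (G≈n a) (pairCH-concatMap w m G n xs G≈n)) (≈-sym (fromℕ-+ (n a) _)))

  evalC*-∷ : ∀ n w f v → evalC* ((fromℕ n , w) ∷ f) v ≈ fromℕ (δᴸ w v * n) +ᴷ evalC* f v
  evalC*-∷ n w f v with List.≡-dec _≟_ w v
  ... | yes refl rewrite δᴸ-refl w = +-cong (≈-reflexive (cong fromℕ (sym (+-identityʳ n)))) ≈-refl
  ... | no w≢v   rewrite δᴸ-≢ w≢v = ≈-sym (+ᴷ-identityˡ _)

  evalC*-map : ∀ v (n : A → ℕ) (f : A → Word) xs →
               evalC* (map (λ a → (fromℕ (n a) , f a)) xs) v ≈ fromℕ (∑ xs (λ a → δᴸ (f a) v * n a))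
  evalC*-map v n f []       = ≈-refl
  evalC*-map v n f (a ∷ xs) =
    ≈-trans (evalC*-∷ (n a) (f a) _ v)
            (≈-trans (+-cong ≈-refl (evalC*-map v n f xs)) (≈-sym (fromℕ-+ (δᴸ (f a) v * n a) _)))

  evalC*-rhs : ∀ ns k v → evalC* (rhs ns k) v ≈ fromℕ (coeff ns v k)
  evalC*-rhs ns k v =
    ≈-trans (evalC*-map v (λ δs → prodℕ (zipWith (λ n d → (n + d) C n) ns δs)) (zipWith _+_ ns)
                        (compositions (length ns) k))
            (≈-reflexive (cong fromℕ (∑-compositions ns k v)))

  ρ*-coeff : ∀ ns k → All (1 ≤_) ns → 1 ≤ k → ∀ v → ρ* ns k v ≈ fromℕ (coeff ns v k)
  ρ*-coeff []          (suc k) _  k≥1 []      = pairCH-degree-0 [] (suc k) 1# [] k≥1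
  ρ*-coeff ns@(_ ∷ _)  (suc k) _  k≥1 []      = pairCH-degree-0 ns (suc k) 1# [] k≥1
  ρ*-coeff ns          k       ps k≥1 (x ∷ v) = begin
    pairCH ns k (concatMap slice R ++ (1# , x ∷ v , 0) ∷ [])
      ≈⟨ pairCH-++ ns k (concatMap slice R) _ ⟩
    pairCH ns k (concatMap slice R) +ᴷ pairCH ns k ((1# , x ∷ v , 0) ∷ [])
      ≈⟨ +-cong (pairCH-concatMap ns k slice sliceWeight R slice-pairing)
                (pairCH-degree-0 ns k 1# (x ∷ v) k≥1) ⟩
    fromℕ (∑ R sliceWeight) +ᴷ 0#
      ≈⟨ +ᴷ-identityʳ _ ⟩
    fromℕ (∑ R sliceWeight)
      ≡⟨ cong fromℕ (∑-degrees-boxes (x ∷ v) ns k ps k≥1) ⟩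
    fromℕ (coeff ns (x ∷ v) k) ∎
    where
    open import Relation.Binary.Reasoning.Setoid (Field.setoid 𝕂)
    R = range (length (x ∷ v)) (sum (x ∷ v) ∸ 1)
    boxesOfDegree : ℕ → List Word
    boxesOfDegree s = filter (λ ks → sum ks ≟ s) (boxes (x ∷ v))
    sliceWeight : ℕ → ℕ
    sliceWeight s = ∑ (boxesOfDegree s) (boxWeight (x ∷ v) ns k)
    slice : ℕ → CH-Sum
    slice s = map (λ ks → (fromℕ (prodℕ (zipWith _C_ (x ∷ v) ks)) , ks , sum (zipWith _∸_ (x ∷ v) ks)))
                  (boxesOfDegree s)
    slice-pairing : ∀ s → pairCH ns k (slice s) ≈ fromℕ (sliceWeight s)
    slice-pairing s = pairCH-map ns k (λ ks → prodℕ (zipWith _C_ (x ∷ v) ks)) (λ ks → ks)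
                                 (λ ks → sum (zipWith _∸_ (x ∷ v) ks)) (boxesOfDegree s)

  ρ*≈rhs : ∀ ns k → All (1 ≤_) ns → 1 ≤ k → ∀ v → ρ* ns k v ≈ evalC* (rhs ns k) v
  ρ*≈rhs ns k ps k≥1 v = ≈-trans (ρ*-coeff ns k ps k≥1 v) (≈-sym (evalC*-rhs ns k v))

  ρ*-[] : ∀ k → 1 ≤ k → ∀ v → ρ* [] k v ≈ 0#
  ρ*-[] (suc k) k≥1 []      = ρ*-coeff [] (suc k) [] k≥1 []
  ρ*-[] (suc k) k≥1 (x ∷ v) = ρ*-coeff [] (suc k) [] k≥1 (x ∷ v)

mainTheorem14 : ∀ {c ℓ} (𝕂 : Field c ℓ) →
  let open Field 𝕂
      open WithField 𝕂
  in
  (∀ (ns : List ℕ) → ns ≢ [] → All (1 ≤_) ns → (k : ℕ) → 1 ≤ k →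
     ∀ (v : List ℕ) → All (1 ≤_) v →
     ρ* ns k v ≈ evalC* (rhs ns k) v)
  ×
  (∀ (k : ℕ) → 1 ≤ k → ∀ (v : List ℕ) → All (1 ≤_) v → ρ* [] k v ≈ 0#)
mainTheorem14 𝕂 = (λ ns _ ps k k≥1 v _ → ρ*≈rhs 𝕂 ns k ps k≥1 v) , (λ k k≥1 v _ → ρ*-[] 𝕂 k k≥1 v)
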